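{- Let $F$ be a 1-essential CSP with solution $\sigma$, let $H^*$ be the *-core of $\Gamma(F,\sigma)$, and let $S\subseteq V(H^*)$ be a flippable set. Then: (a) $A_S$ is weakly flippable; (b) $C_S$ is cyclic; (c) $S\subseteq\mathrm{cl}(A_S\cup C_S)$.
   Context: A CSP is a set of constraints (each an ordered $k$-tuple of variables with a function $\{ -1,1\}^k\to\{0,1\}$); a solution satisfies all constraints. For a constraint satisfied by $\sigma$, a variable is essential if flipping it makes the constraint unsatisfied; the CSP is 1-essential if each of its constraint functions has at most one essential variable under each satisfying assignment. $\Gamma(F,\sigma)$: hypergraph on the variables of $F$, with one hyperedge (its variable set) per constraint having an essential variable under $\sigma$, that variable being the essential vertex. The *-core $H^*$: repeatedly delete a vertex not essential in any remaining hyperedge with all hyperedges containing it. $H_1$: vertices of $H^*$ essential in exactly one hyperedge of $H^*$; for $x\in H_1$, $e(x)$ is that hyperedge. A flippable set is $S\subseteq V(H^*)$ such that for every $x\in S$ and every hyperedge $f$ of $H^*$ in which $x$ is essential, $S$ contains another vertex of $f$. A set $A\subseteq V(H^*)\setminus H_1$ is weakly flippable if there is $P\subseteq H_1$ with $A\cup P$ flippable. A set $\{x_1,\dots,x_l\}\subseteq H_1$ is cyclic if for some permutation $\pi$ of $\{1,\dots,l\}$, $x_{\pi(j)}\in e(x_j)$ for every $j$. For $A\subseteq V(H^*)$, the closure $\mathrm{cl}(A)$ is the set of vertices $x$ such that either $x\in A$, or $x\in H_1\setminus A$ and there is a sequence $x=x_0,x_1,\dots,x_\ell$ with $x_\ell\in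 A$ and, for all $i<\ell$, $x_i\in H_1\setminus A$ and $x_{i+1}\in e(x_i)$. For a flippable $S$, the directed graph $D(S)$ has vertex set $S$ and, for each $x\in S\cap H_1$, one arc $x\to x'$ where $x'$ is a chosen vertex of $S\cap e(x)$ other than $x$ (e.g. the lowest-indexed one). $A_S=S\setminus H_1$, and $C_S$ is the set of vertices lying on directed cycles of $D(S)$. -}

module Defs where

open import Level using (0ℓ)
open import Data.Nat using (ℕ)
open import Data.Fin using (Fin; _≟_)
open import Data.Bool using (Bool; true; false; not; if_then_else_)
open import Data.Product using (Σ; ∃; ∃-syntax; _×_; _,_)
open import Data.Empty using (⊥)
open import Data.Unit using (⊤)
open import Relation.Nullary using (¬_; does)
open import Relation.Unary using (Pred; _∈_; _∉_; _⊆_; _∪_; _∩_; _∖_; ∁; U)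
open import Relation.Binary.PropositionalEquality using (_≡_; _≢_)
open import Relation.Binary.Construct.Closure.Transitive using (TransClosure)
open import Data.Fin.Permutation using (Permutation′; _⟨$⟩ʳ_)
open import Function.Definitions using (Injective)
open import Function.Bundles using (_⇔_)

-- Spins {-1,1} are encoded as Bool; constraint values {0,1} as Bool (true = satisfied).

flipAt : ∀ {k} → Fin k → (Fin k → Bool) → (Fin k → Bool)
flipAt i y j = if does (j ≟ i) then not (y j) else y j

record Constraint (n : ℕ) : Set where
  field
    arity    : ℕ
    scope    : Fin arity → Fin n
    scopeInj : Injective _≡_ _≡_ scope
    fn       : (Fin arity → Bool) → Bool
open Constraint public

CSP : ℕ → ℕ → Set
CSP n m = Fin m → Constraint n

Assignment : ℕ → Set
Assignment n = Fin n → Bool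

Sat : ∀ {n} → Constraint n → Assignment n → Set
Sat c σ = fn c (λ i → σ (scope c i)) ≡ true

Solution : ∀ {n m} → CSP n m → Assignment n → Set
Solution F σ = ∀ a → Sat (F a) σ

InScope : ∀ {n} → Constraint n → Fin n → Set
InScope c v = ∃[ i ] scope c i ≡ v

OneEssentialFn : ∀ {k} → ((Fin k → Bool) → Bool) → Set
OneEssentialFn {k} f = ∀ (y : Fin k → Bool) → f y ≡ true →
  ∀ i j → f (flipAt i y) ≡ false → f (flipAt j y) ≡ false → i ≡ j

OneEssential : ∀ {n m} → CSP n m → Set
OneEssential F = ∀ a → OneEssentialFn (fn (F a))

Essential : ∀ {n m} → CSP n m → Assignment n → Fin m → Fin n → Set
Essential F σ a v = InScope (F a) v × Sat (F a) σ
                  × fn (F a) (λ i → flipAt v σ (scope (F a) i)) ≡ false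

-- Hypergraph Γ(F,σ): hyperedge a (vertex set = variables of constraint a) is present
-- iff constraint a has an essential variable; that variable is its essential vertex.
-- "v is essential in hyperedge a" is thus exactly  Essential F σ a v.

EdgeIn : ∀ {n m} → CSP n m → Fin m → Pred (Fin n) 0ℓ → Set
EdgeIn F a V = ∀ i → V (scope (F a) i)

-- v may be deleted from the current vertex set V: it is not essential in any
-- remaining hyperedge (remaining hyperedges = those of Γ with all vertices in V).
Deletable : ∀ {n m} → CSP n m → Assignment n → Pred (Fin n) 0ℓ → Fin n → Set
Deletable F σ V v = ∀ a → Essential F σ a v → EdgeIn F a V → ⊥

delete : ∀ {n} → Pred (Fin n) 0ℓ → Fin n → Pred (Fin n) 0ℓ
delete V v = V ∖ (λ w → w ≡ v)

data Peels {n m} (F : CSP n m) (σ : Assignment n) :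
       Pred (Fin n) 0ℓ → Pred (Fin n) 0ℓ → Set₁ where
  done : ∀ {V} → Peels F σ V V
  step : ∀ {V W} v → v ∈ V → Deletable F σ V v → Peels F σ (delete V v) W → Peels F σ V W

-- The hyperedges of H* are
-- the hyperedges of Γ all of whose vertices lie in W.
IsStarCore : ∀ {n m} → CSP n m → Assignment n → Pred (Fin n) 0ℓ → Set₁
IsStarCore F σ W = Peels F σ U W × (∀ v → v ∈ W → ¬ Deletable F σ W v)

module Core {n m : ℕ} (F : CSP n m) (σ : Assignment n) (W : Pred (Fin n) 0ℓ) where

  EssCore : Fin m → Fin n → Set
  EssCore a v = Essential F σ a v × EdgeIn F a W

  H₁ : Pred (Fin n) 0ℓ
  H₁ x = x ∈ W × (∃[ a ] (EssCore a x × (∀ b → EssCore b x → b ≡ a)))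

  -- y ∈ e(x)  (for x ∈ H₁, e(x) the unique H*-hyperedge with essential vertex x)
  InE : Fin n → Fin n → Set
  InE x y = ∃[ a ] (EssCore a x × InScope (F a) y)

  Flippable : Pred (Fin n) 0ℓ → Set
  Flippable S = S ⊆ W ×
    (∀ x → x ∈ S → ∀ a → EssCore a x → ∃[ y ] (y ∈ S × InScope (F a) y × y ≢ x))

  WeaklyFlippable : Pred (Fin n) 0ℓ → Set₁
  WeaklyFlippable A = A ⊆ (W ∖ H₁) ×
    Σ (Pred (Fin n) 0ℓ) (λ P → P ⊆ H₁ × Flippable (A ∪ P))

  Cyclic : Pred (Fin n) 0ℓ → Set
  Cyclic X = X ⊆ H₁ ×
    (∃[ l ] Σ (Fin l → Fin n) (λ xs →
       Injective _≡_ _≡_ xs × (∀ y → (y ∈ X) ⇔ (∃[ j ] xs j ≡ y)) ×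
       Σ (Permutation′ l) (λ π → ∀ j → InE (xs j) (xs (π ⟨$⟩ʳ j)))))

  data Cl (A : Pred (Fin n) 0ℓ) : Pred (Fin n) 0ℓ where
    base : ∀ {x} → x ∈ A → Cl A x
    next : ∀ {x y} → x ∈ H₁ → x ∉ A → InE x y → Cl A y → Cl A x

  A[_] : Pred (Fin n) 0ℓ → Pred (Fin n) 0ℓ
  A[ S ] = S ∖ H₁

  ValidChoice : Pred (Fin n) 0ℓ → (Fin n → Fin n) → Set
  ValidChoice S nxt = ∀ x → x ∈ S → x ∈ H₁ → nxt x ∈ S × nxt x ≢ x × InE x (nxt x)

  Arc : Pred (Fin n) 0ℓ → (Fin n → Fin n) → Fin n → Fin n → Set
  Arc S nxt x y = x ∈ S × x ∈ H₁ × y ≡ nxt x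

  C[_,_] : Pred (Fin n) 0ℓ → (Fin n → Fin n) → Pred (Fin n) 0ℓ
  C[ S , nxt ] x = TransClosure (Arc S nxt) x x

module Submission where

-- (a) is immediate: S itself witnesses that A_S is weakly flippable, with
--     P = S ∩ H₁ (every vertex of S is in A_S or in P).
-- (b) and (c) are facts about the directed graph D(S), in which every vertex
--     of S ∩ H₁ has exactly one out-arc, to nxt x.  We therefore first develop
--     the theory of a "functional graph" on Fin n: the graph of a map f
--     restricted to a decidable set G of vertices.  Its cycle vertices are
--     decidable (a closed walk can be shortened below length n by the
--     pigeonhole principle), f maps cycle vertices injectively onto cycle
--     vertices, and every walk of length n+1 inside G meets a cycle.
-- Then (b) follows because f induces a permutation of any enumeration of the
-- cycle vertices, and (c) because following arcs from a vertex of S either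
-- reaches A_S ∪ C_S, or stays outside it for n+1 steps and so meets a cycle.
-- Decidability of H₁ and S is what makes these case distinctions possible;
-- H₁ is decidable because the *-core is obtained by finitely many deletions.

open import Defs
open import Level using (0ℓ)
open import Data.Nat using (ℕ; zero; suc; _+_; _*_; _∸_; _≤_; _<_; s≤s; z≤n)
open import Data.Nat.Properties
  using (<⇒≤; ≤-pred; ≮⇒≥; ≤-trans; <-≤-trans; _<?_; n<1+n; +-suc; m+[n∸m]≡n;
         +-monoʳ-<; +-monoˡ-<; ≤-reflexive; m≤n⇒m≤1+n; anyUpTo?; allUpTo?)
open import Data.Nat.Induction using (<-rec)
open import Data.Nat.Solver using (module +-*-Solver)
open import Data.Fin using (Fin; zero; suc; toℕ) renaming (_≟_ to _≟F_)
open import Data.Fin.Properties using (any?; all?; pigeonhole; toℕ<n)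
open import Data.Fin.Permutation using (Permutation′; permutation; _⟨$⟩ʳ_)
open import Data.Bool using (true; false) renaming (_≟_ to _≟B_)
open import Data.List using (List; _∷_; length; lookup; filter; allFin)
open import Data.List.Relation.Unary.All as All using ()
open import Data.List.Relation.Unary.Any using (index)
open import Data.List.Relation.Unary.Any.Properties using (lookup-index)
open import Data.List.Relation.Unary.Unique.Propositional using (Unique; _∷_)
open import Data.List.Relation.Unary.Unique.Propositional.Properties using (allFin⁺; filter⁺)
open import Data.List.Membership.Propositional.Properties
  using (∈-lookup; ∈-filter⁺; ∈-filter⁻; ∈-allFin)
open import Data.Product using (_×_; _,_; proj₁; proj₂; Σ; ∃-syntax)
open import Data.Sum using (_⊎_; inj₁; inj₂)
open import Data.Empty using (⊥-elim)
open import Relation.Nullary using (¬_; Dec; yes; no)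
open import Relation.Nullary.Decidable using (_×-dec_; _→-dec_; ¬?)
open import Relation.Unary using (Pred; _⊆_; _∪_; _∩_; Decidable; _∈_)
open import Relation.Binary using (Rel)
open import Relation.Binary.PropositionalEquality
  using (_≡_; refl; sym; trans; cong; subst; module ≡-Reasoning)
open import Relation.Binary.Construct.Closure.Transitive using (TransClosure; [_]; _∷_; _∷ʳ_)
open import Function.Definitions using (Injective)
open import Function.Bundles using (_⇔_; mk⇔; Equivalence)

-- An enumeration of X ⊆ Fin n: an injective list x₀,…,x_{l-1} of exactly
-- the elements of X.  This is the shape in which Cyclic lists its vertices.
Enumeration : ∀ {n} → Pred (Fin n) 0ℓ → Set
Enumeration {n} X = ∃[ l ] Σ (Fin l → Fin n) λ xs →
  Injective _≡_ _≡_ xs × (∀ y → (y ∈ X) ⇔ (∃[ j ] xs j ≡ y))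

lookup-injective : ∀ {A : Set} {xs : List A} → Unique xs → Injective _≡_ _≡_ (lookup xs)
lookup-injective {xs = _ ∷ _} _ {zero} {zero} _ = refl
lookup-injective {xs = _ ∷ _} (x∉ ∷ _) {zero} {suc j} e = ⊥-elim (All.lookup x∉ (∈-lookup j) e)
lookup-injective {xs = _ ∷ _} (x∉ ∷ _) {suc i} {zero} e = ⊥-elim (All.lookup x∉ (∈-lookup i) (sym e))
lookup-injective {xs = _ ∷ _} (_ ∷ u) {suc i} {suc j} e = cong suc (lookup-injective u e)

enumerate : ∀ {n} {X : Pred (Fin n) 0ℓ} → Decidable X → Enumeration X
enumerate {n} {X} X? =
  length xs , lookup xs , lookup-injective (filter⁺ X? (allFin⁺ n)) , λ y → mk⇔ (listed y) (member y)
  where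
  xs : List (Fin n)
  xs = filter X? (allFin n)
  listed : ∀ y → y ∈ X → ∃[ j ] lookup xs j ≡ y
  listed y y∈X = let y∈xs = ∈-filter⁺ X? (∈-allFin y) y∈X in index y∈xs , sym (lookup-index y∈xs)
  member : ∀ y → ∃[ j ] lookup xs j ≡ y → y ∈ X
  member y (j , refl) = proj₂ (∈-filter⁻ X? {xs = allFin n} (∈-lookup j))

inducedPermutation : ∀ {n} {X : Pred (Fin n) 0ℓ} (E : Enumeration X) (f : Fin n → Fin n) →
  (∀ {x} → X x → X (f x)) →
  (∀ {x y} → X x → X y → f x ≡ f y → x ≡ y) →
  (∀ {y} → X y → ∃[ x ] (X x × f x ≡ y)) →
  Σ (Permutation′ (proj₁ E)) λ π → ∀ j → proj₁ (proj₂ E) (π ⟨$⟩ʳ j) ≡ f (proj₁ (proj₂ E) j)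
inducedPermutation {n} {X} (l , xs , xs-inj , xs-enum) f maps-to f-inj onto =
  permutation image preimage image∘preimage preimage∘image , xs-image
  where
  listed : ∀ j → X (xs j)
  listed j = Equivalence.from (xs-enum (xs j)) (j , refl)
  position : ∀ {y} → X y → Fin l
  position y∈X = proj₁ (Equivalence.to (xs-enum _) y∈X)
  xs-position : ∀ {y} (y∈X : X y) → xs (position y∈X) ≡ y
  xs-position y∈X = proj₂ (Equivalence.to (xs-enum _) y∈X)
  pre : Fin l → Fin n
  pre j = proj₁ (onto (listed j))
  pre∈X : ∀ j → X (pre j)
  pre∈X j = proj₁ (proj₂ (onto (listed j)))
  image preimage : Fin l → Fin l
  image j = position (maps-to (listed j))
  preimage j = position (pre∈X j)
  xs-image : ∀ j → xs (image j) ≡ f (xs j)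
  xs-image j = xs-position (maps-to (listed j))
  image∘preimage : ∀ j → image (preimage j) ≡ j
  image∘preimage j = xs-inj (begin
    xs (image (preimage j)) ≡⟨ xs-image (preimage j) ⟩
    f (xs (preimage j))     ≡⟨ cong f (xs-position (pre∈X j)) ⟩
    f (pre j)               ≡⟨ proj₂ (proj₂ (onto (listed j))) ⟩
    xs j                    ∎)
    where open ≡-Reasoning
  preimage∘image : ∀ j → preimage (image j) ≡ j
  preimage∘image j = xs-inj (trans (xs-position (pre∈X (image j)))
    (f-inj (pre∈X (image j)) (listed j)
      (trans (proj₂ (proj₂ (onto (listed (image j))))) (xs-image j))))

-- R is the graph of f restricted to G: the only arc out of x ∈ G goes to
-- f x, and vertices outside G have no out-arc.  D(S) is such a graph.
module FunctionalGraph {n : ℕ} (f : Fin n → Fin n)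
  (G : Pred (Fin n) 0ℓ) (G? : Decidable G) (R : Rel (Fin n) 0ℓ)
  (arc⁺ : ∀ {x} → G x → R x (f x)) (arc⁻ : ∀ {x y} → R x y → G x × y ≡ f x) where

  iter : ℕ → Fin n → Fin n
  iter zero x = x
  iter (suc k) x = iter k (f x)

  iter-+ : ∀ i j x → iter (i + j) x ≡ iter j (iter i x)
  iter-+ zero j x = refl
  iter-+ (suc i) j x = iter-+ i j (f x)

  iter-suc : ∀ k x → iter (suc k) x ≡ f (iter k x)
  iter-suc zero x = refl
  iter-suc (suc k) x = iter-suc k (f x)

  iter-periodic : ∀ p c y → iter p y ≡ y → iter (c * p) y ≡ y
  iter-periodic p zero y _ = refl
  iter-periodic p (suc c) y period = begin
    iter (p + c * p) y      ≡⟨ iter-+ p (c * p) y ⟩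
    iter (c * p) (iter p y) ≡⟨ cong (iter (c * p)) period ⟩
    iter (c * p) y          ≡⟨ iter-periodic p c y period ⟩
    y                       ∎
    where open ≡-Reasoning

  iter-repeat : ∀ i j {x} → iter i x ≡ iter j x → ∀ r → iter (i + r) x ≡ iter (j + r) x
  iter-repeat i j {x} eq r =
    trans (iter-+ i r x) (trans (cong (iter r) eq) (sym (iter-+ j r x)))

  orbit-repeats : ∀ x → ∃[ i ] ∃[ j ] (i < j × j ≤ n × iter i x ≡ iter j x)
  orbit-repeats x with pigeonhole (n<1+n n) (λ t → iter (toℕ t) x)
  ... | i , j , i<j , eq = toℕ i , toℕ j , i<j , ≤-pred (toℕ<n j) , eq

  Walk : Fin n → ℕ → Set
  Walk x k = ∀ {t} → t < k → G (iter t x)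

  walk-shorter : ∀ {x k k′} → k ≤ k′ → Walk x k′ → Walk x k
  walk-shorter k≤k′ w t<k = w (<-≤-trans t<k k≤k′)

  walk-drop : ∀ i {x k} → Walk x (i + k) → Walk (iter i x) k
  walk-drop i {x} w {t} t<k = subst G (iter-+ i t x) (w (+-monoʳ-< i t<k))

  Return : Fin n → ℕ → Set
  Return x d = iter (suc d) x ≡ x × Walk x (suc d)

  return? : ∀ x d → Dec (Return x d)
  return? x d = (iter (suc d) x ≟F x) ×-dec allUpTo? (λ t → G? (iter t x)) (suc d)

  OnCycle : Pred (Fin n) 0ℓ
  OnCycle x = TransClosure R x x

  path⇒walk : ∀ {x y} → TransClosure R x y → ∃[ d ] (iter (suc d) x ≡ y × Walk x (suc d))
  path⇒walk [ r ] with arc⁻ r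
  ... | g , refl = 0 , refl , λ { {zero} _ → g ; {suc t} (s≤s ()) }
  path⇒walk (r ∷ rest) with arc⁻ r | path⇒walk rest
  ... | g , refl | d , end , w = suc d , end , λ { {zero} _ → g ; {suc t} (s≤s t<d) → w t<d }

  walk⇒path : ∀ d x → Walk x (suc d) → TransClosure R x (iter (suc d) x)
  walk⇒path zero x w = [ arc⁺ (w (s≤s z≤n)) ]
  walk⇒path (suc d) x w = arc⁺ (w (s≤s z≤n)) ∷ walk⇒path d (f x) (λ t<d → w (s≤s t<d))

  return⇒onCycle : ∀ {x d} → Return x d → OnCycle x
  return⇒onCycle {x} {d} (closed , w) = subst (TransClosure R x) closed (walk⇒path d x w)

  onCycle⇒return : ∀ {x} → OnCycle x → ∃[ d ] Return x d
  onCycle⇒return = path⇒walk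

  onCycle⇒G : ∀ {x} → OnCycle x → G x
  onCycle⇒G c = proj₂ (proj₂ (onCycle⇒return c)) (s≤s z≤n)

  shortReturn : ∀ {x} d → Return x d → ∃[ d′ ] (d′ < n × Return x d′)
  shortReturn {x} = <-rec (λ d → Return x d → ∃[ d′ ] (d′ < n × Return x d′)) shorten
    where
    shorten : ∀ d → (∀ {d′} → d′ < d → Return x d′ → ∃[ d″ ] (d″ < n × Return x d″)) →
              Return x d → ∃[ d′ ] (d′ < n × Return x d′)
    shorten d rec ret with d <? n
    ... | yes d<n = d , d<n , ret
    ... | no d≮n with orbit-repeats x
    ... | i , j , i<j , j≤n , repeat = rec d′<d (closed′ , walk-shorter (s≤s (<⇒≤ d′<d)) (proj₂ ret))
      where
      r : ℕ
      r = d ∸ j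
      j+r≡d : j + r ≡ d
      j+r≡d = m+[n∸m]≡n (≤-trans j≤n (≮⇒≥ d≮n))
      d′ : ℕ
      d′ = i + r
      d′<d : d′ < d
      d′<d = subst (d′ <_) j+r≡d (+-monoˡ-< r i<j)
      -- cutting the loop between positions i and j keeps the walk closed
      closed′ : iter (suc d′) x ≡ x
      closed′ = begin
        iter (suc (i + r)) x ≡⟨ cong (λ k → iter k x) (sym (+-suc i r)) ⟩
        iter (i + suc r) x   ≡⟨ iter-repeat i j repeat (suc r) ⟩
        iter (j + suc r) x   ≡⟨ cong (λ k → iter k x) (trans (+-suc j r) (cong suc j+r≡d)) ⟩
        iter (suc d) x       ≡⟨ proj₁ ret ⟩
        x                    ∎
        where open ≡-Reasoning

  onCycle? : Decidable OnCycle
  onCycle? x with anyUpTo? (return? x) n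
  ... | yes (d , _ , ret) = yes (return⇒onCycle ret)
  ... | no noShort = no λ c → let (d , ret) = onCycle⇒return c in noShort (shortReturn d ret)

  onCycle-f : ∀ {x} → OnCycle x → OnCycle (f x)
  onCycle-f loop@([ r ]) = subst (λ z → TransClosure R z z) (proj₂ (arc⁻ r)) loop
  onCycle-f (r ∷ rest) with arc⁻ r
  ... | _ , refl = rest ∷ʳ r

  onCycle-iter : ∀ k {x} → OnCycle x → OnCycle (iter k x)
  onCycle-iter zero c = c
  onCycle-iter (suc k) c = onCycle-iter k (onCycle-f c)

  -- … onto them: the predecessor of y on its cycle is f^d y …
  onCycle-predecessor : ∀ {y} → OnCycle y → ∃[ x ] (OnCycle x × f x ≡ y)
  onCycle-predecessor {y} c =
    let (d , closed , _) = onCycle⇒return c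
    in iter d y , onCycle-iter d c , trans (sym (iter-suc d y)) closed

  -- … and injectively: if f x = f y = z, then z has periods a+1 and b+1,
  -- and x = f^(b(a+1)+a) z = f^(a(b+1)+b) z = y.
  onCycle-injective : ∀ {x y} → OnCycle x → OnCycle y → f x ≡ f y → x ≡ y
  onCycle-injective {x} {y} cx cy fx≡fy = begin
    x                          ≡⟨ sym (via a (suc a) b (proj₁ (proj₂ ret-x)) z-period-a) ⟩
    iter (b * suc a + a) (f x) ≡⟨ cong (λ k → iter k (f x)) (exponents a b) ⟩
    iter (a * suc b + b) (f x) ≡⟨ via b (suc b) a y-from-z z-period-b ⟩
    y                          ∎
    where
    open ≡-Reasoning
    ret-x : ∃[ a ] Return x a
    ret-x = onCycle⇒return cx
    ret-y : ∃[ b ] Return y b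
    ret-y = onCycle⇒return cy
    a b : ℕ
    a = proj₁ ret-x
    b = proj₁ ret-y
    y-from-z : iter b (f x) ≡ y
    y-from-z = subst (λ z → iter b z ≡ y) (sym fx≡fy) (proj₁ (proj₂ ret-y))
    period-from : ∀ k w → iter k (f x) ≡ w → f w ≡ f x → iter (suc k) (f x) ≡ f x
    period-from k w reach fw = trans (iter-suc k (f x)) (trans (cong f reach) fw)
    z-period-a : iter (suc a) (f x) ≡ f x
    z-period-a = period-from a x (proj₁ (proj₂ ret-x)) refl
    z-period-b : iter (suc b) (f x) ≡ f x
    z-period-b = period-from b y y-from-z (sym fx≡fy)
    via : ∀ k p c {w} → iter k (f x) ≡ w → iter p (f x) ≡ f x → iter (c * p + k) (f x) ≡ w
    via k p c reach period =
      trans (iter-+ (c * p) k (f x)) (trans (cong (iter k) (iter-periodic p c (f x) period)) reach)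
    exponents : ∀ a b → b * suc a + a ≡ a * suc b + b
    exponents = solve 2 (λ a b → b :* (con 1 :+ a) :+ a := a :* (con 1 :+ b) :+ b) refl
      where open +-*-Solver

  longWalk⇒cycle : ∀ {x} → Walk x (suc n) → ∃[ t ] (t < suc n × OnCycle (iter t x))
  longWalk⇒cycle {x} w with orbit-repeats x
  ... | i , j , i<j , j≤n , repeat =
    i , s≤s (≤-trans (<⇒≤ i<j) j≤n) , return⇒onCycle (closed , walk-drop i (walk-shorter i+d≤n w))
    where
    d : ℕ
    d = j ∸ suc i
    i+d≡j : i + suc d ≡ j
    i+d≡j = trans (+-suc i d) (m+[n∸m]≡n i<j)
    i+d≤n : i + suc d ≤ suc n
    i+d≤n = ≤-trans (≤-reflexive i+d≡j) (m≤n⇒m≤1+n j≤n)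
    closed : iter (suc d) (iter i x) ≡ iter i x
    closed = trans (sym (iter-+ i (suc d) x)) (trans (cong (λ k → iter k x) i+d≡j) (sym repeat))

peeling-decidable : ∀ {n m} {F : CSP n m} {σ} {V W : Pred (Fin n) 0ℓ} →
  Peels F σ V W → Decidable V → Decidable W
peeling-decidable done V? = V?
peeling-decidable (step v _ _ rest) V? = peeling-decidable rest (λ w → V? w ×-dec ¬? (w ≟F v))

-- Over a decidable core, H₁ is decidable: all quantifiers in its definition
-- range over the finite sets of constraints and of positions in a scope.
H₁-decidable : ∀ {n m} (F : CSP n m) (σ : Assignment n) {W : Pred (Fin n) 0ℓ} →
  Decidable W → Decidable (Core.H₁ F σ W)
H₁-decidable F σ {W} W? x =
  W? x ×-dec any? (λ a → essCore? a x ×-dec all? (λ b → essCore? b x →-dec (b ≟F a)))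
  where
  open Core F σ W
  essCore? : ∀ a v → Dec (EssCore a v)
  essCore? a v =
    (any? (λ i → scope (F a) i ≟F v)
      ×-dec (fn (F a) (λ i → σ (scope (F a) i)) ≟B true)
      ×-dec (fn (F a) (λ i → flipAt v σ (scope (F a) i)) ≟B false))
    ×-dec all? (λ i → W? (scope (F a) i))

-- A_S is weakly flippable, witnessed by P = S ∩ H₁: then A_S ∪ P = S.
weaklyFlippable : ∀ {n m} (F : CSP n m) (σ : Assignment n) {W S : Pred (Fin n) 0ℓ} →
  Decidable (Core.H₁ F σ W) → Core.Flippable F σ W S → Core.WeaklyFlippable F σ W (Core.A[_] F σ W S)
weaklyFlippable F σ {W} {S} H₁? (S⊆W , S-flip) =
  (λ (x∈S , x∉H₁) → S⊆W x∈S , x∉H₁) , S ∩ H₁ , proj₂ , (λ x∈ → S⊆W (inS x∈)) , flip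
  where
  open Core F σ W
  T : Pred (Fin _) 0ℓ
  T = A[ S ] ∪ (S ∩ H₁)
  inS : ∀ {x} → x ∈ T → x ∈ S
  inS (inj₁ (x∈S , _)) = x∈S
  inS (inj₂ (x∈S , _)) = x∈S
  split : ∀ {y} → y ∈ S → y ∈ T
  split {y} y∈S with H₁? y
  ... | yes y∈H₁ = inj₂ (y∈S , y∈H₁)
  ... | no y∉H₁ = inj₁ (y∈S , y∉H₁)
  flip : ∀ x → x ∈ T → ∀ a → EssCore a x → ∃[ y ] (y ∈ T × InScope (F a) y × ¬ y ≡ x)
  flip x x∈T a ess =
    let (y , y∈S , y∈a , y≢x) = S-flip x (inS x∈T) a ess in y , split y∈S , y∈a , y≢x

module DirectedGraph {n m : ℕ} (F : CSP n m) (σ : Assignment n) (W : Pred (Fin n) 0ℓ)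
  (H₁? : Decidable (Core.H₁ F σ W)) (S : Pred (Fin n) 0ℓ) (S? : Decidable S)
  (nxt : Fin n → Fin n) (valid : Core.ValidChoice F σ W S nxt) where
  open Core F σ W

  Source : Pred (Fin n) 0ℓ
  Source = S ∩ H₁

  open FunctionalGraph nxt Source (λ x → S? x ×-dec H₁? x) (Arc S nxt)
    (λ (x∈S , x∈H₁) → x∈S , x∈H₁ , refl) (λ (x∈S , x∈H₁ , y≡) → (x∈S , x∈H₁) , y≡)

  -- (b) enumerate C_S; nxt permutes it, and x_j → nxt x_j is an arc of e(x_j)
  cyclic : Cyclic C[ S , nxt ]
  cyclic =
    let (π , xs-π) = inducedPermutation E nxt onCycle-f onCycle-injective onCycle-predecessor
    in (λ c → proj₂ (onCycle⇒G c)) , l , xs , xs-inj , xs-enum , π , λ j →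
         let (x∈S , x∈H₁) = onCycle⇒G (listed j)
         in subst (InE (xs j)) (sym (xs-π j)) (proj₂ (proj₂ (valid (xs j) x∈S x∈H₁)))
    where
    E : Enumeration OnCycle
    E = enumerate onCycle?
    l : ℕ
    l = proj₁ E
    xs : Fin l → Fin n
    xs = proj₁ (proj₂ E)
    xs-inj : Injective _≡_ _≡_ xs
    xs-inj = proj₁ (proj₂ (proj₂ E))
    xs-enum : ∀ y → (y ∈ OnCycle) ⇔ (∃[ j ] xs j ≡ y)
    xs-enum = proj₂ (proj₂ (proj₂ E))
    listed : ∀ j → OnCycle (xs j)
    listed j = Equivalence.from (xs-enum (xs j)) (j , refl)

  B : Pred (Fin n) 0ℓ
  B = A[ S ] ∪ C[ S , nxt ]

  AvoidsCycles : Fin n → ℕ → Set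
  AvoidsCycles x k = ∀ {t} → t < k → Source (iter t x) × ¬ OnCycle (iter t x)

  follow : ∀ k x → x ∈ S → Cl B x ⊎ AvoidsCycles x k
  follow zero x _ = inj₂ λ ()
  follow (suc k) x x∈S with onCycle? x | H₁? x
  ... | yes x∈C | _ = inj₁ (base (inj₂ x∈C))
  ... | no _ | no x∉H₁ = inj₁ (base (inj₁ (x∈S , x∉H₁)))
  ... | no x∉C | yes x∈H₁ with valid x x∈S x∈H₁
  ... | nxt∈S , _ , nxt∈e with follow k (nxt x) nxt∈S
  ... | inj₁ nxt∈cl = inj₁ (next x∈H₁ x∉B nxt∈e nxt∈cl)
    where
    x∉B : ¬ B x
    x∉B (inj₁ (_ , x∉H₁)) = x∉H₁ x∈H₁
    x∉B (inj₂ x∈C) = x∉C x∈C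
  ... | inj₂ avoids = inj₂ λ { {zero} _ → (x∈S , x∈H₁) , x∉C ; {suc t} (s≤s t<k) → avoids t<k }

  -- n+1 cycle-free steps are impossible, so every x ∈ S lies in cl(B)
  closure : S ⊆ Cl B
  closure {x} x∈S with follow (suc n) x x∈S
  ... | inj₁ x∈cl = x∈cl
  ... | inj₂ avoids =
    let (t , t≤n , cycle) = longWalk⇒cycle (λ t<n → proj₁ (avoids t<n))
    in ⊥-elim (proj₂ (avoids t≤n) cycle)

proposition12p7 : ∀ {n m : ℕ} (F : CSP n m) (σ : Assignment n) →
    OneEssential F → Solution F σ →
    (W : Pred (Fin n) 0ℓ) → IsStarCore F σ W →
    (S : Pred (Fin n) 0ℓ) → Decidable S → Core.Flippable F σ W S →
    (nxt : Fin n → Fin n) → Core.ValidChoice F σ W S nxt →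
    Core.WeaklyFlippable F σ W (Core.A[_] F σ W S)
    × Core.Cyclic F σ W (Core.C[_,_] F σ W S nxt)
    × S ⊆ Core.Cl F σ W (Core.A[_] F σ W S ∪ Core.C[_,_] F σ W S nxt)
proposition12p7 F σ _ _ W (peeling , _) S S? S-flippable nxt valid =
  weaklyFlippable F σ H₁? S-flippable , cyclic , closure
  where
  H₁? : Decidable (Core.H₁ F σ W)
  H₁? = H₁-decidable F σ (peeling-decidable peeling (λ _ → yes _))
  open DirectedGraph F σ W H₁? S S? nxt valid
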